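{- Let $n\ge 2$ be an integer and let $p_k$ be the largest prime divisor of $n$. If $n$ is reduced, then so is $np_{k+1}$.
   Context: Let $p_i$ denote the $i$-th prime ($p_1=2$). A positive integer $2^{a_1}3^{a_2}5^{a_3}\cdots=\prod_i p_i^{a_i}$ (with $a_i=0$ for all sufficiently large $i$) is called reduced if $\left\lfloor\frac{a_i+1}{a_j+2}\right\rfloor<\frac{\log p_j}{\log p_i}$ whenever $i,j\ne1$, and $2^{a_1}<8p_j^2$ whenever $a_j=0$. -}

module Defs where

open import Data.Nat using (ℕ; suc; _+_; _*_; _^_; _<_; _≤_)
open import Data.Nat.DivMod using (_/_)
open import Data.Nat.Divisibility using (_∣_)
open import Data.Nat.Primality using (Prime)
open import Data.Product using (_×_)
open import Relation.Nullary using (¬_)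
open import Relation.Binary.PropositionalEquality using (_≢_)

-- p-adic valuation, relationally: the exponent of p in n is exactly a
-- (meaningful for n ≥ 1).
ExactPow : ℕ → ℕ → ℕ → Set
ExactPow p a n = (p ^ a ∣ n) × ¬ (p ^ suc a ∣ n)

-- With a_i = v_{p_i}(n):
--  (1) for odd primes p, q (indices i,j ≠ 1):
--        floor((a_p+1)/(a_q+2)) < log q / log p,
--      written equivalently (p > 1, floor is a natural number m) as  p ^ m < q;
--  (2) for every prime q with a_q = 0 :  2 ^ (a_2) < 8 q².
Reduced : ℕ → Set
Reduced n =
  (∀ p q a b → Prime p → Prime q → p ≢ 2 → q ≢ 2 →
     ExactPow p a n → ExactPow q b n →
     p ^ (suc a / suc (suc b)) < q)
  × (∀ q a → Prime q → ¬ (q ∣ n) → ExactPow 2 a n →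
     2 ^ a < 8 * (q * q))

NextPrime : ℕ → ℕ → Set
NextPrime p q = Prime q × p < q × (∀ r → Prime r → p < r → q ≤ r)

LargestPrimeDivisor : ℕ → ℕ → Set
LargestPrimeDivisor p n = Prime p × p ∣ n × (∀ r → Prime r → r ∣ n → r ≤ p)

-- Since q > p, q ∤ n, so multiplying by q changes only the exponent of q, from
-- 0 to 1.  Every condition for nq is then inherited from n, except q^⌊2/2⌋ < s
-- for an odd prime s ∤ n: there, if p is odd, the condition for n at (p, s) gives
-- p ≤ p^⌊(a_p+1)/2⌋ < s, and a prime s > p other than q exceeds q.
module Submission where

open import Defs
open import Data.Nat
open import Data.Nat.Properties
open import Data.Nat.DivMod using (_/_; m<n⇒m/n≡0; m≥n⇒m/n>0; /-monoʳ-≤)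
open import Data.Nat.Divisibility
open import Data.Nat.Primality
open import Data.Nat.Coprimality using (Coprime; coprime-divisor)
open import Data.Nat.Induction using (<-wellFounded; Acc; acc)
open import Data.Product using (_,_; proj₁; proj₂; ∃-syntax)
open import Data.Sum using (inj₁; inj₂)
open import Data.Empty using (⊥-elim)
open import Relation.Nullary using (¬_; yes; no)
open import Relation.Binary.PropositionalEquality

private variable
  a b m n p q r s : ℕ

prime⇒>1 : Prime p → 1 < p
prime⇒>1 {p} pp = nonTrivial⇒n>1 p {{prime⇒nonTrivial pp}}

prime∣prime^⇒≡ : ∀ k → Prime q → Prime r → q ∣ r ^ k → q ≡ r
prime∣prime^⇒≡ zero pq pr q∣1 = ⊥-elim (<⇒≢ (prime⇒>1 pq) (sym (∣1⇒≡1 q∣1)))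
prime∣prime^⇒≡ {q} {r} (suc k) pq pr q∣r^k+1 with euclidsLemma r (r ^ k) pq q∣r^k+1
... | inj₂ q∣r^k = prime∣prime^⇒≡ k pq pr q∣r^k
... | inj₁ q∣r with prime⇒irreducible pr q∣r
...   | inj₁ q≡1 = ⊥-elim (<⇒≢ (prime⇒>1 pq) (sym q≡1))
...   | inj₂ q≡r = q≡r

coprime-prime^ : ∀ k → Prime q → Prime r → r ≢ q → Coprime (r ^ k) q
coprime-prime^ k pq pr r≢q (d∣r^k , d∣q) with prime⇒irreducible pq d∣q
... | inj₁ d≡1 = d≡1
... | inj₂ refl = ⊥-elim (r≢q (sym (prime∣prime^⇒≡ k pq pr d∣r^k)))

^-monoʳ-∣ : ∀ p → m ≤ n → p ^ m ∣ p ^ n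
^-monoʳ-∣ {n = n} p z≤n = 1∣ (p ^ n)
^-monoʳ-∣ p (s≤s m≤n) = *-monoʳ-∣ p (^-monoʳ-∣ p m≤n)

exactPow-unique : ExactPow p a m → ExactPow p b m → a ≡ b
exactPow-unique {p} (p^a∣m , p^a+1∤m) (p^b∣m , p^b+1∤m) = ≤-antisym
  (≮⇒≥ λ b<a → p^b+1∤m (∣-trans (^-monoʳ-∣ p b<a) p^a∣m))
  (≮⇒≥ λ a<b → p^a+1∤m (∣-trans (^-monoʳ-∣ p a<b) p^b∣m))

exactPow-0 : ¬ p ∣ n → ExactPow p 0 n
exactPow-0 {p} {n} p∤n = 1∣ n , λ p*1∣n → p∤n (subst (_∣ n) (*-identityʳ p) p*1∣n)

exactPow-0⁻¹ : ExactPow p 0 n → ¬ p ∣ n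
exactPow-0⁻¹ {p} {n} (_ , p^1∤n) p∣n = p^1∤n (subst (_∣ n) (sym (*-identityʳ p)) p∣n)

exactPow-*ʳ : .{{NonZero p}} → ExactPow p a m → ExactPow p (suc a) (m * p)
exactPow-*ʳ {p} {a} {m} (p^a∣m , p^a+1∤m) =
    subst (p ^ suc a ∣_) (*-comm p m) (*-monoʳ-∣ p p^a∣m)
  , λ p^a+2∣m*p → p^a+1∤m (*-cancelˡ-∣ p (subst (p ^ suc (suc a) ∣_) (*-comm m p) p^a+2∣m*p))

exactPow-exists : 1 < p → ∀ n → .{{NonZero n}} → ∃[ a ] ExactPow p a n
exactPow-exists {p} 1<p n = go n (<-wellFounded n)
  where
  instance
    p≢0 : NonZero p
    p≢0 = >-nonZero (<-trans z<s 1<p)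

  go : ∀ m → .{{NonZero m}} → Acc _<_ m → ∃[ a ] ExactPow p a m
  go m (acc smaller) with p ∣? m
  ... | no p∤m = 0 , exactPow-0 p∤m
  ... | yes (divides k refl) with go k {{m*n≢0⇒m≢0 k}} (smaller (m<m*n k p {{m*n≢0⇒m≢0 k}} 1<p))
  ...   | a , k-exact = suc a , exactPow-*ʳ {a = a} k-exact

exactPow-pos : ∀ a → p ∣ n → ExactPow p a n → 0 < a
exactPow-pos zero p∣n p-exact = ⊥-elim (exactPow-0⁻¹ p-exact p∣n)
exactPow-pos (suc _) _ _ = z<s

exactPow-cancel-prime : ∀ a → Prime q → Prime r → r ≢ q → ExactPow r a (n * q) → ExactPow r a n
exactPow-cancel-prime {q} {r} {n} a pq pr r≢q (r^a∣nq , r^a+1∤nq) =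
    coprime-divisor (coprime-prime^ a pq pr r≢q) (subst (r ^ a ∣_) (*-comm n q) r^a∣nq)
  , λ r^a+1∣n → r^a+1∤nq (∣-trans r^a+1∣n (m∣m*n q))

exactPow-*-newPrime : ∀ a → Prime q → ¬ q ∣ n → ExactPow q a (n * q) → a ≡ 1
exactPow-*-newPrime a pq q∤n q-exact =
  exactPow-unique q-exact (exactPow-*ʳ {a = 0} {{prime⇒nonZero pq}} (exactPow-0 q∤n))

OddPrimeCondition : ℕ → Set
OddPrimeCondition n = ∀ p q a b → Prime p → Prime q → p ≢ 2 → q ≢ 2 →
  ExactPow p a n → ExactPow q b n → p ^ (suc a / suc (suc b)) < q

TwoAdicCondition : ℕ → Set
TwoAdicCondition n = ∀ q a → Prime q → ¬ (q ∣ n) → ExactPow 2 a n → 2 ^ a < 8 * (q * q)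

twoAdicCondition-*-oddPrime : Prime q → q ≢ 2 → TwoAdicCondition n → TwoAdicCondition (n * q)
twoAdicCondition-*-oddPrime {q} pq q≢2 two s a ps s∤nq two-exact =
  two s a ps (λ s∣n → s∤nq (∣-trans s∣n (m∣m*n q)))
    (exactPow-cancel-prime a pq prime[2] (λ 2≡q → q≢2 (sym 2≡q)) two-exact)

largestPrimeDivisor<oddNonDivisor : .{{NonZero n}} → OddPrimeCondition n →
  LargestPrimeDivisor p n → Prime s → s ≢ 2 → ¬ s ∣ n → p < s
largestPrimeDivisor<oddNonDivisor {n} {p} {s} odd (pp , p∣n , _) ps s≢2 s∤n with p ≟ 2
... | yes refl = ≤∧≢⇒< (prime⇒>1 ps) (λ 2≡s → s≢2 (sym 2≡s))
... | no p≢2 with exactPow-exists (prime⇒>1 pp) n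
...   | a , p-exact = begin-strict
  p                    ≡⟨ ^-identityʳ p ⟨
  p ^ 1                ≤⟨ ^-monoʳ-≤ p {{prime⇒nonZero pp}} (m≥n⇒m/n>0 (s≤s (exactPow-pos a p∣n p-exact))) ⟩
  p ^ (suc a / 2)      <⟨ odd p s a 0 pp ps p≢2 s≢2 p-exact (exactPow-0 s∤n) ⟩
  s                    ∎
  where open ≤-Reasoning

nextPrime≢2 : Prime p → NextPrime p q → q ≢ 2
nextPrime≢2 pp (_ , p<q , _) refl = <⇒≱ p<q (prime⇒>1 pp)

nextPrime∤ : LargestPrimeDivisor p n → NextPrime p q → ¬ q ∣ n
nextPrime∤ (_ , _ , p-max) (pq , p<q , _) q∣n = <⇒≱ p<q (p-max _ pq q∣n)

module _ .{{_ : NonZero n}} (largest : LargestPrimeDivisor p n) (next : NextPrime p q)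
         (odd : OddPrimeCondition n) where

  private
    pq : Prime q
    pq = proj₁ next

    q≤nextPrimes : Prime s → p < s → q ≤ s
    q≤nextPrimes = proj₂ (proj₂ next) _

    q∤n : ¬ q ∣ n
    q∤n = nextPrime∤ largest next

    q≢2 : q ≢ 2
    q≢2 = nextPrime≢2 (proj₁ largest) next

    exactPow-down : ∀ a → Prime r → r ≢ q → ExactPow r a (n * q) → ExactPow r a n
    exactPow-down a = exactPow-cancel-prime a pq

    q^[2/2+b]<s : ∀ b → Prime s → s ≢ 2 → s ≢ q → ExactPow s b n → q ^ (2 / (2 + b)) < s
    q^[2/2+b]<s (suc b) ps _ _ _ rewrite m<n⇒m/n≡0 {2} {3 + b} (s≤s (s≤s z<s)) = prime⇒>1 ps
    q^[2/2+b]<s {s} zero ps s≢2 s≢q s-exact = subst (_< s) (sym (^-identityʳ q))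
      (≤∧≢⇒< (q≤nextPrimes ps p<s) (λ q≡s → s≢q (sym q≡s)))
      where
      p<s = largestPrimeDivisor<oddNonDivisor odd largest ps s≢2 (exactPow-0⁻¹ s-exact)

  oddPrimeCondition-*-nextPrime : OddPrimeCondition (n * q)
  oddPrimeCondition-*-nextPrime r s a b pr ps r≢2 s≢2 r-exact s-exact with r ≟ q | s ≟ q
  ... | no r≢q | no s≢q =
    odd r s a b pr ps r≢2 s≢2 (exactPow-down a pr r≢q r-exact) (exactPow-down b ps s≢q s-exact)
  ... | yes refl | yes refl
    with refl ← exactPow-*-newPrime a pq q∤n r-exact | refl ← exactPow-*-newPrime b pq q∤n s-exact = prime⇒>1 pq
  ... | yes refl | no s≢q
    with refl ← exactPow-*-newPrime a pq q∤n r-exact = q^[2/2+b]<s b ps s≢2 s≢q (exactPow-down b ps s≢q s-exact)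
  ... | no r≢q | yes refl
    with refl ← exactPow-*-newPrime b pq q∤n s-exact = ≤-<-trans
      (^-monoʳ-≤ r {{prime⇒nonZero pr}} (/-monoʳ-≤ (suc a) (s≤s (s≤s z≤n))))
      (odd r q a 0 pr pq r≢2 q≢2 (exactPow-down a pr r≢q r-exact) (exactPow-0 q∤n))

lemma3p12 : ∀ (n p q : ℕ) → 2 ≤ n → LargestPrimeDivisor p n → NextPrime p q →
    Reduced n → Reduced (n * q)
lemma3p12 n p q n≥2 largest next@(pq , _) (odd , two) =
    oddPrimeCondition-*-nextPrime largest next odd
  , twoAdicCondition-*-oddPrime pq (nextPrime≢2 (proj₁ largest) next) two
  where
  instance
    n≢0 : NonZero n
    n≢0 = >-nonZero (<-≤-trans z<s n≥2)
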